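{- Let $r\ge 2$, $k\ge 3$, and let $\widehat{F}_k$ be any $r$-coloring of $K_k$. If $G$ is an $(r, \widehat{F}_k)$-extremal graph and $u, v\in V(G)$ are any non-adjacent vertices, then the graph obtained from $G$ by deleting $v$ and then adding a new vertex $\widetilde{u}$ that is non-adjacent to $u$ and has the same neighborhood as $u$ (cloning $u$) is also $(r, \widehat{F}_k)$-extremal.
   Context: An $r$-coloring is any map from the edge set to $\{1,\dots,r\}$. An $r$-coloring of a graph contains $\widehat{F}_k$ if there are $k$ pairwise adjacent vertices and a bijection $\varphi$ from $V(K_k)$ to them such that two edges of $K_k$ have the same color in $\widehat{F}_k$ iff their images have the same color; otherwise it is $\widehat{F}_k$-free. $c_{r,\widehat{F}_k}(G)$ is the number of $\widehat{F}_k$-free $r$-colorings of $E(G)$, $c_{r,\widehat{F}_k}(n)$ its maximum over $n$-vertex graphs, and $G$ is $(r,\widehat{F}_k)$-extremal if $c_{r,\widehat{F}_k}(G)=c_{r,\widehat{F}_k}(|V(G)|)$. -}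

module Defs where

open import Data.Bool using (Bool; true; false; not; _∧_; _∨_; if_then_else_)
open import Data.Nat using (ℕ; zero; suc; _+_; _≤_; _<_)
open import Data.Fin using (Fin; _≟_)
import Data.Fin.Properties as FinP
open import Data.Fin.Properties using (any?; all?)
open import Data.List using (List; []; _∷_; length; allFin; concatMap; filter; map)
open import Data.Nat.ListAction using (sum)
open import Data.Vec using (Vec; []; _∷_; lookup)
open import Data.Maybe using (Maybe; just; nothing)
import Data.Maybe.Properties as MaybeP
open import Data.Product using (Σ; ∃; _×_; _,_; proj₁; proj₂)
open import Relation.Nullary using (¬_; Dec; yes; no; does)
open import Relation.Nullary.Decidable using (_×-dec_; _→-dec_; ¬?; map′)
open import Relation.Binary.PropositionalEquality using (_≡_; _≢_; refl; sym; trans; cong)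

record Graph (n : ℕ) : Set where
  field
    adj    : Fin n → Fin n → Bool
    adj-sym    : ∀ x y → adj x y ≡ adj y x
    adj-irrefl : ∀ x → adj x x ≡ false
open Graph public

edgeList : ∀ {n} → Graph n → List (Fin n × Fin n)
edgeList {n} G =
  filter (λ p → adj G (proj₁ p) (proj₂ p) Data.Bool.≟ true)
    (filter (λ p → proj₁ p Data.Fin.<? proj₂ p)
      (concatMap (λ i → map (λ j → (i , j)) (allFin n)) (allFin n)))

Coloring : ∀ {n} → Graph n → ℕ → Set
Coloring G r = Vec (Fin r) (length (edgeList G))

assoc : ∀ {n r} (es : List (Fin n × Fin n)) → Vec (Fin r) (length es) →
        Fin n → Fin n → Maybe (Fin r)
assoc [] [] x y = nothing
assoc ((i , j) ∷ es) (c ∷ cs) x y =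
  if (does (x ≟ i) ∧ does (y ≟ j)) ∨ (does (x ≟ j) ∧ does (y ≟ i))
  then just c else assoc es cs x y

colorOf : ∀ {n r} (G : Graph n) → Coloring G r → Fin n → Fin n → Maybe (Fin r)
colorOf G c = assoc (edgeList G) c

private
  ≢-sym-bool : ∀ {k} (x y : Fin k) → not (does (x ≟ y)) ≡ not (does (y ≟ x))
  ≢-sym-bool x y with x ≟ y | y ≟ x
  ... | yes _ | yes _ = refl
  ... | no _  | no _  = refl
  ... | yes p | no q  = Data.Empty.⊥-elim (q (sym p))
    where import Data.Empty
  ... | no p  | yes q = Data.Empty.⊥-elim (p (sym q))
    where import Data.Empty

  ≡-refl-bool : ∀ {k} (x : Fin k) → not (does (x ≟ x)) ≡ false
  ≡-refl-bool x with x ≟ x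
  ... | yes _ = refl
  ... | no p  = Data.Empty.⊥-elim (p refl)
    where import Data.Empty

K : (k : ℕ) → Graph k
K k = record
  { adj    = λ x y → not (does (x ≟ y))
  ; adj-sym    = ≢-sym-bool
  ; adj-irrefl = ≡-refl-bool
  }

Contains : ∀ {n r k} (F : Coloring (K k) r) (G : Graph n) → Coloring G r → Set
Contains {n} {r} {k} F G c =
  Σ (Vec (Fin n) k) λ φ →
    (∀ a b → a ≢ b → lookup φ a ≢ lookup φ b) ×
    (∀ a b → a ≢ b → adj G (lookup φ a) (lookup φ b) ≡ true) ×
    (∀ a b a' b' → a ≢ b → a' ≢ b' →
       (colorOf (K k) F a b ≡ colorOf (K k) F a' b' →
          colorOf G c (lookup φ a) (lookup φ b) ≡ colorOf G c (lookup φ a') (lookup φ b')) ×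
       (colorOf G c (lookup φ a) (lookup φ b) ≡ colorOf G c (lookup φ a') (lookup φ b') →
          colorOf (K k) F a b ≡ colorOf (K k) F a' b'))

∃Vec? : ∀ {n k} {P : Vec (Fin n) k → Set} → (∀ v → Dec (P v)) → Dec (Σ (Vec (Fin n) k) P)
∃Vec? {k = zero} P? = map′ (λ p → [] , p) (λ { ([] , p) → p }) (P? [])
∃Vec? {n} {k = suc k} {P} P? =
  map′ (λ { (a , w , p) → a ∷ w , p }) (λ { ((a ∷ w) , p) → a , w , p })
       (any? (λ a → ∃Vec? {n} {k} {λ w → P (a ∷ w)} (λ w → P? (a ∷ w))))

Contains? : ∀ {n r k} (F : Coloring (K k) r) (G : Graph n) (c : Coloring G r) →
            Dec (Contains F G c)
Contains? {n} {r} {k} F G c = ∃Vec? λ φ →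
  all? (λ a → all? (λ b → ¬? (a ≟ b) →-dec ¬? (lookup φ a ≟ lookup φ b))) ×-dec
  (all? (λ a → all? (λ b → ¬? (a ≟ b) →-dec (adj G (lookup φ a) (lookup φ b) Data.Bool.≟ true))) ×-dec
   all? (λ a → all? (λ b → all? (λ a' → all? (λ b' →
     ¬? (a ≟ b) →-dec (¬? (a' ≟ b') →-dec
       ((MaybeP.≡-dec _≟_ (colorOf (K k) F a b) (colorOf (K k) F a' b') →-dec
           MaybeP.≡-dec _≟_ (colorOf G c (lookup φ a) (lookup φ b)) (colorOf G c (lookup φ a') (lookup φ b'))) ×-dec
        (MaybeP.≡-dec _≟_ (colorOf G c (lookup φ a) (lookup φ b)) (colorOf G c (lookup φ a') (lookup φ b')) →-dec
           MaybeP.≡-dec _≟_ (colorOf (K k) F a b) (colorOf (K k) F a' b')))))))))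

countVec : ∀ r m → (Vec (Fin r) m → Bool) → ℕ
countVec r zero    p = if p [] then 1 else 0
countVec r (suc m) p = sum (map (λ a → countVec r m (λ w → p (a ∷ w))) (allFin r))

cFree : ∀ {n} (r k : ℕ) → Coloring (K k) r → Graph n → ℕ
cFree {n} r k F G = countVec r (length (edgeList G)) (λ c → not (does (Contains? {n} {r} {k} F G c)))

Extremal : ∀ {n} (r k : ℕ) → Coloring (K k) r → Graph n → Set
Extremal {n} r k F G = ∀ (H : Graph n) → cFree r k F H ≤ cFree r k F G

-- Delete v and add a non-adjacent clone ũ of u; ũ is placed at the freed label v.
cloneOver : ∀ {n} → Graph n → Fin n → Fin n → Graph n
cloneOver {n} G u v = record
  { adj    = λ x y → adj G (f x) (f y)
  ; adj-sym    = λ x y → adj-sym G (f x) (f y)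
  ; adj-irrefl = λ x → adj-irrefl G (f x)
  }
  where
    f : Fin n → Fin n
    f x = if does (x ≟ v) then u else x

module Submission where

open import Defs
open import Data.Nat using (ℕ; _≤_)
open import Data.Bool using (false)
open import Data.Fin using (Fin)
open import Relation.Binary.PropositionalEquality using (_≡_; _≢_)
open import Relation.Binary.Definitions using (DecidableEquality)

-- Fix a non-edge uv of G. Colour first the edges avoiding u and v; for such a partial
-- colouring σ let a(σ) count the colourings of the edges at u for which G − v contains no
-- copy of the pattern, and b(σ) likewise with u and v exchanged. A copy of K_k never uses
-- both u and v, so c(G) = Σ_σ a(σ) b(σ). Cloning u over v gives Σ_σ a(σ)², and cloning v over
-- u gives Σ_σ b(σ)², which is at most c(G) by extremality. By Cauchy–Schwarz
-- c(G)² ≤ Σ a² · Σ b² ≤ c(G with u cloned over v) · c(G), hence c(G) ≤ c(G with u cloned over v).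

module Sums where
  open import Data.List using (List; []; _∷_; map)
  open import Data.Nat using (ℕ; zero; suc; _+_; _*_; _≤_; z≤n)
  open import Data.Nat.ListAction using (sum)
  open import Data.Nat.Properties
  open import Algebra.Properties.CommutativeSemigroup +-commutativeSemigroup using (interchange)
  open import Data.Nat.Tactic.RingSolver using (solve-∀)
  open import Data.Product using (_,_)
  open import Data.Sum using (inj₁; inj₂)
  open import Relation.Nullary using (yes; no)
  open import Relation.Nullary.Negation using (contradiction)
  open import Relation.Binary.PropositionalEquality

  module _ {A : Set} where

    sum-map-zero : ∀ (xs : List A) → sum (map (λ _ → 0) xs) ≡ 0
    sum-map-zero []       = refl
    sum-map-zero (x ∷ xs) = sum-map-zero xs

    sum-map-*ʳ : ∀ (f : A → ℕ) c xs → sum (map (λ a → f a * c) xs) ≡ sum (map f xs) * c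
    sum-map-*ʳ f c []       = refl
    sum-map-*ʳ f c (x ∷ xs) =
      trans (cong (f x * c +_) (sum-map-*ʳ f c xs)) (sym (*-distribʳ-+ c (f x) _))

    sum-map-+ : ∀ (f g : A → ℕ) xs →
                sum (map (λ a → f a + g a) xs) ≡ sum (map f xs) + sum (map g xs)
    sum-map-+ f g []       = refl
    sum-map-+ f g (x ∷ xs) =
      trans (cong (f x + g x +_) (sum-map-+ f g xs)) (interchange (f x) (g x) _ _)

  sum-map-comm : ∀ {A B : Set} (h : A → B → ℕ) xs ys →
                 sum (map (λ a → sum (map (h a) ys)) xs) ≡
                 sum (map (λ b → sum (map (λ a → h a b) xs)) ys)
  sum-map-comm h []       ys = sym (sum-map-zero ys)
  sum-map-comm h (x ∷ xs) ys = trans (cong (sum (map (h x) ys) +_) (sum-map-comm h xs ys))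
                                      (sym (sum-map-+ (h x) _ ys))

  sq : ℕ → ℕ
  sq x = x * x

  sq-cancel-≤ : ∀ {m n} → sq m ≤ sq n → m ≤ n
  sq-cancel-≤ {m} {n} sq[m]≤sq[n] with m ≤? n
  ... | yes m≤n = m≤n
  ... | no  m≰n = contradiction sq[m]≤sq[n] (<⇒≱ (*-mono-< (≰⇒> m≰n) (≰⇒> m≰n)))

  m*m≤n*m⇒m≤n : ∀ m n → m * m ≤ n * m → m ≤ n
  m*m≤n*m⇒m≤n zero    n _ = z≤n
  m*m≤n*m⇒m≤n (suc m) n p = *-cancelʳ-≤ (suc m) n (suc m) p

  private
    4*m*n≤sq[m+n]-ordered : ∀ {m n} → m ≤ n → 4 * (m * n) ≤ sq (m + n)
    4*m*n≤sq[m+n]-ordered {m} m≤n with d , refl ← m≤n⇒∃[o]m+o≡n m≤n =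
      subst (4 * (m * (m + d)) ≤_) (expand m d) (m≤m+n _ (d * d))
      where
      expand : ∀ m d → 4 * (m * (m + d)) + d * d ≡ (m + (m + d)) * (m + (m + d))
      expand = solve-∀

  4*m*n≤sq[m+n] : ∀ m n → 4 * (m * n) ≤ sq (m + n)
  4*m*n≤sq[m+n] m n with ≤-total m n
  ... | inj₁ m≤n = 4*m*n≤sq[m+n]-ordered m≤n
  ... | inj₂ n≤m = subst₂ _≤_ (cong (4 *_) (*-comm n m)) (cong sq (+-comm n m))
                              (4*m*n≤sq[m+n]-ordered n≤m)

  cauchySchwarz-+ : ∀ s t {a b c d} → sq s ≤ a * c → sq t ≤ b * d →
                    sq (s + t) ≤ (a + b) * (c + d)
  cauchySchwarz-+ s t {a} {b} {c} {d} s²≤ac t²≤bd = begin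
    sq (s + t)                      ≡⟨ expand-sq s t ⟩
    sq s + 2 * (s * t) + sq t       ≤⟨ +-mono-≤ (+-mono-≤ s²≤ac 2st≤ad+bc) t²≤bd ⟩
    a * c + (a * d + b * c) + b * d ≡⟨ expand-* a b c d ⟩
    (a + b) * (c + d)               ∎
    where
    open ≤-Reasoning
    expand-sq : ∀ s t → (s + t) * (s + t) ≡ s * s + 2 * (s * t) + t * t
    expand-sq = solve-∀
    expand-* : ∀ a b c d → a * c + (a * d + b * c) + b * d ≡ (a + b) * (c + d)
    expand-* = solve-∀
    sq-2st : ∀ s t → 2 * (s * t) * (2 * (s * t)) ≡ 4 * (s * s * (t * t))
    sq-2st = solve-∀
    regroup : ∀ a b c d → a * c * (b * d) ≡ a * d * (b * c)
    regroup = solve-∀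
    2st≤ad+bc : 2 * (s * t) ≤ a * d + b * c
    2st≤ad+bc = sq-cancel-≤ (begin
      sq (2 * (s * t))          ≡⟨ sq-2st s t ⟩
      4 * (sq s * sq t)         ≤⟨ *-monoʳ-≤ 4 (*-mono-≤ s²≤ac t²≤bd) ⟩
      4 * (a * c * (b * d))     ≡⟨ cong (4 *_) (regroup a b c d) ⟩
      4 * (a * d * (b * c))     ≤⟨ 4*m*n≤sq[m+n] (a * d) (b * c) ⟩
      sq (a * d + b * c)        ∎)

  sum-map-cauchySchwarz : ∀ {A : Set} (s f g : A → ℕ) xs → (∀ x → sq (s x) ≤ f x * g x) →
                          sq (sum (map s xs)) ≤ sum (map f xs) * sum (map g xs)
  sum-map-cauchySchwarz s f g []       _ = z≤n
  sum-map-cauchySchwarz s f g (x ∷ xs) p =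
    cauchySchwarz-+ (s x) _ {f x} {_} {g x} (p x) (sum-map-cauchySchwarz s f g xs p)

module Recolouring {K : Set} (_≟_ : DecidableEquality K) (r : ℕ) where
  open import Data.Bool using (if_then_else_)
  open import Data.Fin using (Fin)
  open import Data.List using (List; []; _∷_; _++_; map; allFin)
  open import Data.List.Properties using (map-cong)
  open import Data.List.Membership.Propositional using (_∉_)
  open import Data.List.Relation.Unary.All using (All; []; _∷_)
  open import Data.List.Relation.Unary.Any using (here; there)
  open import Data.List.Relation.Binary.Permutation.Propositional using (_↭_; refl; prep; swap; trans)
  open import Data.Nat using (_*_; _≤_)
  open import Data.Nat.ListAction using (sum)
  open import Data.Nat.Properties using (*-comm; ≤-reflexive)
  open import Data.Nat.Tactic.RingSolver using (solve-∀)
  open import Relation.Binary.Core using (_Preserves_⟶_)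
  open import Relation.Nullary using (Dec; yes; no; does)
  open import Relation.Nullary.Negation using (contradiction)
  open import Relation.Binary.PropositionalEquality as ≡
    using (_≡_; _≢_; _≗_; refl; cong; module ≡-Reasoning)

  open Sums using (sq; sum-map-*ʳ; sum-map-comm; sum-map-cauchySchwarz)

  Colouring : Set
  Colouring = K → Fin r

  infixl 6 _[_]≔_

  _[_]≔_ : Colouring → K → Fin r → Colouring
  (σ [ k ]≔ a) k′ = if does (k′ ≟ k) then a else σ k′

  []≔-here : ∀ σ k a → (σ [ k ]≔ a) k ≡ a
  []≔-here σ k a with k ≟ k
  ... | yes _   = refl
  ... | no  k≢k = contradiction refl k≢k

  []≔-there : ∀ σ {k k′} a → k′ ≢ k → (σ [ k ]≔ a) k′ ≡ σ k′
  []≔-there σ {k} {k′} a k′≢k with k′ ≟ k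
  ... | yes k′≡k = contradiction k′≡k k′≢k
  ... | no  _    = refl

  []≔-cong : ∀ {σ τ} → σ ≗ τ → ∀ k a → σ [ k ]≔ a ≗ τ [ k ]≔ a
  []≔-cong σ≗τ k a k′ with k′ ≟ k
  ... | yes _ = refl
  ... | no  _ = σ≗τ k′

  []≔-idem : ∀ σ k a b → σ [ k ]≔ a [ k ]≔ b ≗ σ [ k ]≔ b
  []≔-idem σ k a b k′ with k′ ≟ k
  ... | yes _ = refl
  ... | no  _ = refl

  []≔-comm : ∀ σ {k k′} a b → k ≢ k′ → σ [ k ]≔ a [ k′ ]≔ b ≗ σ [ k′ ]≔ b [ k ]≔ a
  []≔-comm σ {k} {k′} a b k≢k′ x with x ≟ k′ | x ≟ k
  ... | yes refl | yes refl = contradiction refl k≢k′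
  ... | yes _    | no  _    = refl
  ... | no  _    | yes _    = refl
  ... | no  _    | no  _    = refl

  -- For distinct keys ks, recolourSum ks w ρ sums w over the colourings that agree with ρ off ks.
  recolourSum : List K → (Colouring → ℕ) → Colouring → ℕ
  recolourSum []       w ρ = w ρ
  recolourSum (k ∷ ks) w ρ = sum (map (λ a → recolourSum ks w (ρ [ k ]≔ a)) (allFin r))

  Extensional : (Colouring → ℕ) → Set
  Extensional w = w Preserves _≗_ ⟶ _≡_

  Ignores : K → (Colouring → ℕ) → Set
  Ignores k w = ∀ σ a → w (σ [ k ]≔ a) ≡ w σ

  private
    sum-allFin-cong : ∀ {f g : Fin r → ℕ} → f ≗ g →
                      sum (map f (allFin r)) ≡ sum (map g (allFin r))
    sum-allFin-cong f≗g = cong sum (map-cong f≗g (allFin r))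

  recolourSum-cong : ∀ {w w′} → w ≗ w′ → ∀ ks → recolourSum ks w ≗ recolourSum ks w′
  recolourSum-cong w≗w′ []       ρ = w≗w′ ρ
  recolourSum-cong w≗w′ (k ∷ ks) ρ = sum-allFin-cong λ a → recolourSum-cong w≗w′ ks (ρ [ k ]≔ a)

  recolourSum-extensional : ∀ {w} → Extensional w → ∀ ks → Extensional (recolourSum ks w)
  recolourSum-extensional ext-w []       σ≗τ = ext-w σ≗τ
  recolourSum-extensional ext-w (k ∷ ks) σ≗τ =
    sum-allFin-cong λ a → recolourSum-extensional ext-w ks ([]≔-cong σ≗τ k a)

  recolourSum-++ : ∀ w xs ys → recolourSum (xs ++ ys) w ≗ recolourSum xs (recolourSum ys w)
  recolourSum-++ w []       ys ρ = refl
  recolourSum-++ w (x ∷ xs) ys ρ = sum-allFin-cong λ a → recolourSum-++ w xs ys (ρ [ x ]≔ a)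

  recolourSum-fixed : ∀ {w w′} k a ks → k ∉ ks → (∀ σ → σ k ≡ a → w σ ≡ w′ σ) →
                      ∀ ρ → ρ k ≡ a → recolourSum ks w ρ ≡ recolourSum ks w′ ρ
  recolourSum-fixed k a []        k∉ks w≡w′ ρ ρk≡a = w≡w′ ρ ρk≡a
  recolourSum-fixed k a (k′ ∷ ks) k∉ks w≡w′ ρ ρk≡a = sum-allFin-cong λ b →
    recolourSum-fixed k a ks (λ k∈ks → k∉ks (there k∈ks)) w≡w′ (ρ [ k′ ]≔ b)
      (≡.trans ([]≔-there ρ b (λ k≡k′ → k∉ks (here k≡k′))) ρk≡a)

  recolourSum-ignores : ∀ {w} → Extensional w → ∀ {k} → Ignores k w → ∀ ks →
                        Ignores k (recolourSum ks w)
  recolourSum-ignores ext-w ign []        σ a = ign σ a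
  recolourSum-ignores {w} ext-w {k} ign (k′ ∷ ks) σ a = sum-allFin-cong λ b → update b (k ≟ k′)
    where
    update : ∀ b → Dec (k ≡ k′) →
             recolourSum ks w (σ [ k ]≔ a [ k′ ]≔ b) ≡ recolourSum ks w (σ [ k′ ]≔ b)
    update b (yes refl) = recolourSum-extensional ext-w ks ([]≔-idem σ k a b)
    update b (no  k≢k′) = ≡.trans (recolourSum-extensional ext-w ks ([]≔-comm σ a b k≢k′))
                                  (recolourSum-ignores ext-w ign ks (σ [ k′ ]≔ b) a)

  recolourSum-*ʳ : ∀ {f g} → Extensional f → ∀ ks → All (λ k → Ignores k g) ks →
                   ∀ ρ → recolourSum ks (λ σ → f σ * g σ) ρ ≡ recolourSum ks f ρ * g ρ
  recolourSum-*ʳ ext-f []       []           ρ = refl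
  recolourSum-*ʳ {f} {g} ext-f (k ∷ ks) (ign ∷ igns) ρ = begin
    sum (map (λ a → recolourSum ks (λ σ → f σ * g σ) (ρ [ k ]≔ a)) (allFin r))
      ≡⟨ sum-allFin-cong (λ a → ≡.trans (recolourSum-*ʳ ext-f ks igns (ρ [ k ]≔ a))
                                        (cong (recolourSum ks f (ρ [ k ]≔ a) *_) (ign ρ a))) ⟩
    sum (map (λ a → recolourSum ks f (ρ [ k ]≔ a) * g ρ) (allFin r))
      ≡⟨ sum-map-*ʳ (λ a → recolourSum ks f (ρ [ k ]≔ a)) (g ρ) (allFin r) ⟩
    recolourSum (k ∷ ks) f ρ * g ρ ∎
    where open ≡-Reasoning

  recolourSum-*ˡ : ∀ {f g} → Extensional g → ∀ ks → All (λ k → Ignores k f) ks →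
                   ∀ ρ → recolourSum ks (λ σ → f σ * g σ) ρ ≡ f ρ * recolourSum ks g ρ
  recolourSum-*ˡ {f} {g} ext-g ks igns ρ = begin
    recolourSum ks (λ σ → f σ * g σ) ρ ≡⟨ recolourSum-cong (λ σ → *-comm (f σ) (g σ)) ks ρ ⟩
    recolourSum ks (λ σ → g σ * f σ) ρ ≡⟨ recolourSum-*ʳ ext-g ks igns ρ ⟩
    recolourSum ks g ρ * f ρ           ≡⟨ *-comm _ (f ρ) ⟩
    f ρ * recolourSum ks g ρ           ∎
    where open ≡-Reasoning

  recolourSum-swap : ∀ {w} → Extensional w → ∀ x y ks ρ →
                     recolourSum (x ∷ y ∷ ks) w ρ ≡ recolourSum (y ∷ x ∷ ks) w ρ
  recolourSum-swap {w} ext-w x y ks ρ with x ≟ y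
  ... | yes refl = refl
  ... | no x≢y = ≡.trans
    (sum-allFin-cong λ a → sum-allFin-cong λ b → recolourSum-extensional ext-w ks ([]≔-comm ρ a b x≢y))
    (sum-map-comm (λ a b → recolourSum ks w (ρ [ y ]≔ b [ x ]≔ a)) (allFin r) (allFin r))

  recolourSum-↭ : ∀ {w} → Extensional w → ∀ {xs ys} → xs ↭ ys →
                  recolourSum xs w ≗ recolourSum ys w
  recolourSum-↭ ext-w refl                       ρ = refl
  recolourSum-↭ ext-w (prep k xs↭ys)             ρ = sum-allFin-cong λ a → recolourSum-↭ ext-w xs↭ys (ρ [ k ]≔ a)
  recolourSum-↭ ext-w (swap {ys = ys} x y xs↭ys) ρ =
    ≡.trans (sum-allFin-cong λ a → sum-allFin-cong λ b → recolourSum-↭ ext-w xs↭ys (ρ [ x ]≔ a [ y ]≔ b))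
            (recolourSum-swap ext-w x y ys ρ)
  recolourSum-↭ ext-w (trans xs↭ys ys↭zs)        ρ =
    ≡.trans (recolourSum-↭ ext-w xs↭ys ρ) (recolourSum-↭ ext-w ys↭zs ρ)

  recolourSum-cauchySchwarz : ∀ (f g : Colouring → ℕ) ks ρ →
    sq (recolourSum ks (λ σ → f σ * g σ) ρ) ≤
    recolourSum ks (λ σ → sq (f σ)) ρ * recolourSum ks (λ σ → sq (g σ)) ρ
  recolourSum-cauchySchwarz f g []       ρ = ≤-reflexive (regroup (f ρ) (g ρ))
    where
    regroup : ∀ x y → x * y * (x * y) ≡ x * x * (y * y)
    regroup = solve-∀
  recolourSum-cauchySchwarz f g (k ∷ ks) ρ =
    sum-map-cauchySchwarz _ _ _ (allFin r) (λ a → recolourSum-cauchySchwarz f g ks (ρ [ k ]≔ a))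

  recolourSum-simulation : ∀ {B : Set} (κ₁ κ₂ : B → K) {w₁ w₂}
    (R : List B → Colouring → Colouring → Set) →
    (∀ {σ₁ σ₂} → R [] σ₁ σ₂ → w₁ σ₁ ≡ w₂ σ₂) →
    (∀ {y ys σ₁ σ₂} a → R (y ∷ ys) σ₁ σ₂ → R ys (σ₁ [ κ₁ y ]≔ a) (σ₂ [ κ₂ y ]≔ a)) →
    ∀ ys {σ₁ σ₂} → R ys σ₁ σ₂ → recolourSum (map κ₁ ys) w₁ σ₁ ≡ recolourSum (map κ₂ ys) w₂ σ₂
  recolourSum-simulation κ₁ κ₂ R done step []       rel = done rel
  recolourSum-simulation κ₁ κ₂ R done step (y ∷ ys) rel =
    sum-allFin-cong λ a → recolourSum-simulation κ₁ κ₂ R done step ys (step a rel)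

module Copies {n r k : ℕ} (F : Coloring (K k) r) where
  open import Data.Bool using (Bool; true; false; not; _∧_; if_then_else_)
  import Data.Bool.Properties as Bool
  open import Data.Fin using (Fin; _≟_)
  open import Data.Fin.Properties using (any?; all?)
  open import Data.Maybe using (Maybe)
  import Data.Maybe.Properties as Maybe
  open import Data.Nat using (_*_)
  open import Data.Product using (Σ; _×_; _,_; proj₁; proj₂)
  open import Data.Sum using (_⊎_; inj₁; inj₂)
  open import Data.Vec using (Vec; lookup)
  import Data.Vec as Vec
  open import Data.Vec.Properties using (lookup-map)
  open import Function.Base using (id)
  open import Function.Bundles using (_⇔_; mk⇔; Equivalence)
  open import Function.Definitions using (Injective)
  open import Relation.Nullary using (Dec; yes; no; does)
  open import Relation.Nullary.Decidable using (_×-dec_; _→-dec_; ¬?; does-⇔)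
  open import Relation.Nullary.Negation using (contradiction)
  open import Relation.Binary.PropositionalEquality
    using (_≡_; _≢_; refl; sym; trans; cong; cong₂; subst₂)

  Adjacency : Set
  Adjacency = Fin n → Fin n → Bool

  ColourFn : Set
  ColourFn = Fin n → Fin n → Maybe (Fin r)

  -- Contains F G c unfolds to HasCopy (adj G) (colorOf G c), and Contains? to hasCopy?.
  HasCopy : Adjacency → ColourFn → Set
  HasCopy A C =
    Σ (Vec (Fin n) k) λ φ →
      (∀ a b → a ≢ b → lookup φ a ≢ lookup φ b) ×
      (∀ a b → a ≢ b → A (lookup φ a) (lookup φ b) ≡ true) ×
      (∀ a b a' b' → a ≢ b → a' ≢ b' →
         (colorOf (K k) F a b ≡ colorOf (K k) F a' b' →
            C (lookup φ a) (lookup φ b) ≡ C (lookup φ a') (lookup φ b')) ×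
         (C (lookup φ a) (lookup φ b) ≡ C (lookup φ a') (lookup φ b') →
            colorOf (K k) F a b ≡ colorOf (K k) F a' b'))

  hasCopy? : ∀ A C → Dec (HasCopy A C)
  hasCopy? A C = ∃Vec? λ φ →
    all? (λ a → all? (λ b → ¬? (a ≟ b) →-dec ¬? (lookup φ a ≟ lookup φ b))) ×-dec
    (all? (λ a → all? (λ b → ¬? (a ≟ b) →-dec (A (lookup φ a) (lookup φ b) Bool.≟ true))) ×-dec
     all? (λ a → all? (λ b → all? (λ a' → all? (λ b' →
       ¬? (a ≟ b) →-dec (¬? (a' ≟ b') →-dec
         ((Maybe.≡-dec _≟_ (colorOf (K k) F a b) (colorOf (K k) F a' b') →-dec
             Maybe.≡-dec _≟_ (C (lookup φ a) (lookup φ b)) (C (lookup φ a') (lookup φ b'))) ×-dec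
          (Maybe.≡-dec _≟_ (C (lookup φ a) (lookup φ b)) (C (lookup φ a') (lookup φ b')) →-dec
             Maybe.≡-dec _≟_ (colorOf (K k) F a b) (colorOf (K k) F a' b')))))))))

  isFree : Adjacency → ColourFn → Bool
  isFree A C = not (does (hasCopy? A C))

  free : Adjacency → ColourFn → ℕ
  free A C = if isFree A C then 1 else 0

  Transports : (Fin n → Fin n) → Adjacency → ColourFn → Adjacency → ColourFn → Set
  Transports π A C B D = ∀ x y → A x y ≡ true → B (π x) (π y) ≡ true × D (π x) (π y) ≡ C x y

  hasCopy-map : ∀ (π : Fin n → Fin n) → Injective _≡_ _≡_ π → ∀ {A C B D} →
                Transports π A C B D → HasCopy A C → HasCopy B D
  hasCopy-map π π-inj {A} {C} {B} {D} trp (φ , distinct , adjacent , same-pattern) =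
    φ′ , distinct′ , adjacent′ , same-pattern′
    where
    φ′ : Vec (Fin n) k
    φ′ = Vec.map π φ
    lookup-φ′ : ∀ a → lookup φ′ a ≡ π (lookup φ a)
    lookup-φ′ a = lookup-map a π φ
    distinct′ : ∀ a b → a ≢ b → lookup φ′ a ≢ lookup φ′ b
    distinct′ a b a≢b eq = distinct a b a≢b (π-inj (trans (sym (lookup-φ′ a)) (trans eq (lookup-φ′ b))))
    adjacent′ : ∀ a b → a ≢ b → B (lookup φ′ a) (lookup φ′ b) ≡ true
    adjacent′ a b a≢b = trans (cong₂ B (lookup-φ′ a) (lookup-φ′ b)) (proj₁ (trp _ _ (adjacent a b a≢b)))
    colour-φ′ : ∀ a b → a ≢ b → D (lookup φ′ a) (lookup φ′ b) ≡ C (lookup φ a) (lookup φ b)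
    colour-φ′ a b a≢b = trans (cong₂ D (lookup-φ′ a) (lookup-φ′ b)) (proj₂ (trp _ _ (adjacent a b a≢b)))
    same-pattern′ : ∀ a b a′ b′ → a ≢ b → a′ ≢ b′ →
      (colorOf (K k) F a b ≡ colorOf (K k) F a′ b′ → D (lookup φ′ a) (lookup φ′ b) ≡ D (lookup φ′ a′) (lookup φ′ b′)) ×
      (D (lookup φ′ a) (lookup φ′ b) ≡ D (lookup φ′ a′) (lookup φ′ b′) → colorOf (K k) F a b ≡ colorOf (K k) F a′ b′)
    same-pattern′ a b a′ b′ a≢b a′≢b′ =
      (λ same → trans (colour-φ′ a b a≢b)
                  (trans (proj₁ (same-pattern a b a′ b′ a≢b a′≢b′) same) (sym (colour-φ′ a′ b′ a′≢b′)))) ,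
      (λ same → proj₂ (same-pattern a b a′ b′ a≢b a′≢b′)
                  (trans (sym (colour-φ′ a b a≢b)) (trans same (colour-φ′ a′ b′ a′≢b′))))

  isFree-map : ∀ (π ψ : Fin n → Fin n) → Injective _≡_ _≡_ π → Injective _≡_ _≡_ ψ → ∀ {A C B D} →
               Transports π A C B D → Transports ψ B D A C → isFree A C ≡ isFree B D
  isFree-map π ψ π-inj ψ-inj {A} {C} {B} {D} there back = cong not
    (does-⇔ (mk⇔ (hasCopy-map π π-inj {A} {C} {B} {D} there) (hasCopy-map ψ ψ-inj {B} {D} {A} {C} back))
            (hasCopy? A C) (hasCopy? B D))

  free-map : ∀ (π ψ : Fin n → Fin n) → Injective _≡_ _≡_ π → Injective _≡_ _≡_ ψ → ∀ {A C B D} →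
             Transports π A C B D → Transports ψ B D A C → free A C ≡ free B D
  free-map π ψ π-inj ψ-inj {A} {C} {B} {D} there back =
    cong (λ b → if b then 1 else 0) (isFree-map π ψ π-inj ψ-inj {A} {C} {B} {D} there back)

  isFree-cong : ∀ {A C B D} → Transports id A C B D → Transports id B D A C →
                isFree A C ≡ isFree B D
  isFree-cong {A} {C} {B} {D} = isFree-map id id (λ eq → eq) (λ eq → eq) {A} {C} {B} {D}

  free-cong : ∀ {A C B D} → Transports id A C B D → Transports id B D A C → free A C ≡ free B D
  free-cong {A} {C} {B} {D} there back =
    cong (λ b → if b then 1 else 0) (isFree-cong {A} {C} {B} {D} there back)

  infixl 5 _─_

  _─_ : Adjacency → Fin n → Adjacency
  (A ─ w) x y = not (does (x ≟ w)) ∧ not (does (y ≟ w)) ∧ A x y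

  ─-true⁺ : ∀ {A w x y} → x ≢ w → y ≢ w → A x y ≡ true → (A ─ w) x y ≡ true
  ─-true⁺ {A} {w} {x} {y} x≢w y≢w Axy with x ≟ w | y ≟ w
  ... | yes x≡w | _       = contradiction x≡w x≢w
  ... | no _    | yes y≡w = contradiction y≡w y≢w
  ... | no _    | no _    = Axy

  ─-true⁻ : ∀ {A w x y} → (A ─ w) x y ≡ true → x ≢ w × y ≢ w × A x y ≡ true
  ─-true⁻ {A} {w} {x} {y} eq with x ≟ w | y ≟ w
  ... | no x≢w | no y≢w = x≢w , y≢w , eq

  hasCopy-─ : ∀ {A} w {C} → HasCopy (A ─ w) C → HasCopy A C
  hasCopy-─ {A} w {C} = hasCopy-map id (λ eq → eq) {A ─ w} {C} {A} {C}
    λ x y eq → proj₂ (proj₂ (─-true⁻ {A} {w} eq)) , refl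

  -- A copy of K_k cannot use both ends of a non-edge, so it survives deleting one of them.
  hasCopy-split : ∀ (H : Graph n) {u v} → adj H u v ≡ false → u ≢ v → ∀ {C} →
                  HasCopy (adj H) C → HasCopy (adj H ─ v) C ⊎ HasCopy (adj H ─ u) C
  hasCopy-split H {u} {v} uv∉H u≢v {C} (φ , distinct , adjacent , same-pattern)
    with any? (λ a → lookup φ a ≟ v)
  ... | no v∉φ = inj₁ (φ , distinct ,
          (λ a b a≢b → ─-true⁺ {adj H} (λ eq → v∉φ (a , eq)) (λ eq → v∉φ (b , eq)) (adjacent a b a≢b)) ,
          same-pattern)
  ... | yes (a₀ , φa₀≡v) = inj₂ (φ , distinct ,
          (λ a b a≢b → ─-true⁺ {adj H} (u∉φ a) (u∉φ b) (adjacent a b a≢b)) , same-pattern)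
    where
    u∉φ : ∀ b → lookup φ b ≢ u
    u∉φ b φb≡u with b ≟ a₀
    ... | yes refl = u≢v (trans (sym φb≡u) φa₀≡v)
    ... | no b≢a₀  = contradiction (trans (sym uv∉H) (trans (adj-sym H u v) vu∈H)) λ ()
      where
      vu∈H : adj H v u ≡ true
      vu∈H = subst₂ (λ p q → adj H p q ≡ true) φa₀≡v φb≡u (adjacent a₀ b (λ eq → b≢a₀ (sym eq)))

  private
    indicator¬ : {P : Set} → Dec P → ℕ
    indicator¬ P? = if not (does P?) then 1 else 0

    indicator¬-⊎ : {P Q R : Set} (P? : Dec P) (Q? : Dec Q) (R? : Dec R) → P ⇔ (Q ⊎ R) →
                   indicator¬ P? ≡ indicator¬ Q? * indicator¬ R?
    indicator¬-⊎ (yes _) (yes _) _       _       = refl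
    indicator¬-⊎ (yes _) (no _)  (yes _) _       = refl
    indicator¬-⊎ (yes p) (no ¬q) (no ¬r) P⇔Q⊎R with Equivalence.to P⇔Q⊎R p
    ... | inj₁ q = contradiction q ¬q
    ... | inj₂ r = contradiction r ¬r
    indicator¬-⊎ (no ¬p) (yes q) _       P⇔Q⊎R = contradiction (Equivalence.from P⇔Q⊎R (inj₁ q)) ¬p
    indicator¬-⊎ (no ¬p) (no _)  (yes r) P⇔Q⊎R = contradiction (Equivalence.from P⇔Q⊎R (inj₂ r)) ¬p
    indicator¬-⊎ (no _)  (no _)  (no _)  _       = refl

  free-split : ∀ (H : Graph n) {u v} → adj H u v ≡ false → u ≢ v → ∀ C →
               free (adj H) C ≡ free (adj H ─ v) C * free (adj H ─ u) C
  free-split H {u} {v} uv∉H u≢v C =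
    indicator¬-⊎ (hasCopy? (adj H) C) (hasCopy? (adj H ─ v) C) (hasCopy? (adj H ─ u) C)
      (mk⇔ (hasCopy-split H uv∉H u≢v {C}) λ { (inj₁ copy) → hasCopy-─ {adj H} v {C} copy
                                             ; (inj₂ copy) → hasCopy-─ {adj H} u {C} copy })

module Edges (n : ℕ) where
  open import Data.Bool using (true; false)
  import Data.Bool as Bool
  open import Data.Fin using (Fin; _≟_; _<_; _<?_)
  open import Data.Fin.Properties using (<-asym; <-cmp; <⇒≢)
  open import Data.List using (List; []; _∷_; _++_; map; filter; allFin; concatMap; cartesianProduct)
  open import Data.List.Properties using (filter-≐)
  open import Data.List.Membership.Propositional using (_∈_)
  open import Data.List.Membership.Propositional.Properties
    using (∈-filter⁻; ∈-filter⁺; ∈-map⁻; ∈-map⁺; ∈-allFin; ∈-++⁻; ∈-++⁺ˡ; ∈-++⁺ʳ; ∈-cartesianProduct⁺)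
  open import Data.List.Membership.Propositional.Properties.WithK using (unique∧set⇒bag)
  open import Data.List.Relation.Binary.BagAndSetEquality using (∼bag⇒↭)
  open import Data.List.Relation.Binary.Disjoint.Propositional using (Disjoint)
  open import Data.List.Relation.Binary.Permutation.Propositional using (_↭_)
  open import Data.List.Relation.Unary.Unique.Propositional using (Unique)
  import Data.List.Relation.Unary.Unique.Propositional.Properties as Unique
  open import Data.Product using (∃; _×_; _,_; proj₁; proj₂)
  import Data.Product.Properties as Product
  open import Data.Sum using (_⊎_; inj₁; inj₂)
  open import Function.Bundles using (mk⇔)
  open import Relation.Binary.Definitions using (DecidableEquality; tri<; tri≈; tri>)
  open import Relation.Nullary using (Dec; yes; no; ¬_)
  open import Relation.Nullary.Decidable using (_×-dec_; _⊎-dec_; ¬?)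
  open import Relation.Nullary.Negation using (contradiction)
  open import Relation.Binary.PropositionalEquality using (_≡_; _≢_; refl; sym; trans; cong; subst)


  Pair : Set
  Pair = Fin n × Fin n

  _≟ₚ_ : DecidableEquality Pair
  _≟ₚ_ = Product.≡-dec _≟_ _≟_

  Ordered : Pair → Set
  Ordered (i , j) = i < j

  sortPair : Fin n → Fin n → Pair
  sortPair x y with x <? y
  ... | yes _ = x , y
  ... | no  _ = y , x

  sortPair-< : ∀ {i j} → i < j → sortPair i j ≡ (i , j)
  sortPair-< {i} {j} i<j with i <? j
  ... | yes _   = refl
  ... | no  i≮j = contradiction i<j i≮j

  sortPair-cases : ∀ x y → sortPair x y ≡ (x , y) ⊎ sortPair x y ≡ (y , x)
  sortPair-cases x y with x <? y
  ... | yes _ = inj₁ refl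
  ... | no  _ = inj₂ refl

  sortPair-ordered : ∀ {x y} → x ≢ y → Ordered (sortPair x y)
  sortPair-ordered {x} {y} x≢y with x <? y | <-cmp x y
  ... | yes x<y | _           = x<y
  ... | no  x≮y | tri< x<y _ _ = contradiction x<y x≮y
  ... | no  _   | tri≈ _ x≡y _ = contradiction x≡y x≢y
  ... | no  _   | tri> _ _ y<x = y<x

  sortPair-comm : ∀ {x y} → x ≢ y → sortPair x y ≡ sortPair y x
  sortPair-comm {x} {y} x≢y with x <? y | y <? x
  ... | yes x<y | yes y<x = contradiction y<x (<-asym x<y)
  ... | yes _   | no  _   = refl
  ... | no  _   | yes _   = refl
  ... | no  x≮y | no  y≮x with <-cmp x y
  ...   | tri< x<y _ _ = contradiction x<y x≮y
  ...   | tri≈ _ x≡y _ = contradiction x≡y x≢y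
  ...   | tri> _ _ y<x = contradiction y<x y≮x

  sortPair-≡⁻ : ∀ {a b c d} → sortPair a b ≡ sortPair c d → (a ≡ c × b ≡ d) ⊎ (a ≡ d × b ≡ c)
  sortPair-≡⁻ {a} {b} {c} {d} eq with sortPair-cases a b | sortPair-cases c d
  ... | inj₁ ab | inj₁ cd with refl ← trans (sym ab) (trans eq cd) = inj₁ (refl , refl)
  ... | inj₁ ab | inj₂ dc with refl ← trans (sym ab) (trans eq dc) = inj₂ (refl , refl)
  ... | inj₂ ba | inj₁ cd with refl ← trans (sym ba) (trans eq cd) = inj₂ (refl , refl)
  ... | inj₂ ba | inj₂ dc with refl ← trans (sym ba) (trans eq dc) = inj₁ (refl , refl)

  sortPair-injʳ : ∀ {a b b′} → sortPair a b ≡ sortPair a b′ → b ≡ b′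
  sortPair-injʳ eq with sortPair-≡⁻ eq
  ... | inj₁ (_ , b≡b′)   = b≡b′
  ... | inj₂ (a≡b′ , b≡a) = trans b≡a a≡b′

  sortPair-avoids : ∀ {w x y} z → x ≢ w → y ≢ w → sortPair x y ≢ sortPair w z
  sortPair-avoids z x≢w y≢w eq with sortPair-≡⁻ eq
  ... | inj₁ (x≡w , _) = x≢w x≡w
  ... | inj₂ (_ , y≡w) = y≢w y≡w

  Matches : Pair → Fin n → Fin n → Set
  Matches (i , j) x y = (x ≡ i × y ≡ j) ⊎ (x ≡ j × y ≡ i)

  -- does (matches? (i , j) x y) is definitionally the test by which assoc finds the colour of {x , y}.
  matches? : ∀ p x y → Dec (Matches p x y)
  matches? (i , j) x y = (x ≟ i ×-dec y ≟ j) ⊎-dec (x ≟ j ×-dec y ≟ i)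

  matches-sortPair : ∀ {p x y} → Ordered p → Matches p x y → sortPair x y ≡ p
  matches-sortPair i<j (inj₁ (refl , refl)) = sortPair-< i<j
  matches-sortPair i<j (inj₂ (refl , refl)) =
    trans (sortPair-comm (λ eq → <⇒≢ i<j (sym eq))) (sortPair-< i<j)

  sortPair-matches : ∀ x y → Matches (sortPair x y) x y
  sortPair-matches x y with sortPair x y | sortPair-cases x y
  ... | _ | inj₁ refl = inj₁ (refl , refl)
  ... | _ | inj₂ refl = inj₂ (refl , refl)

  IsEdge : Graph n → Pair → Set
  IsEdge H (i , j) = adj H i j ≡ true

  private
    allPairs : List Pair
    allPairs = concatMap (λ i → map (λ j → (i , j)) (allFin n)) (allFin n)

    allPairs≡cartesianProduct : ∀ (xs ys : List (Fin n)) →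
      concatMap (λ i → map (λ j → (i , j)) ys) xs ≡ cartesianProduct xs ys
    allPairs≡cartesianProduct []       ys = refl
    allPairs≡cartesianProduct (x ∷ xs) ys = cong (map (x ,_) ys ++_) (allPairs≡cartesianProduct xs ys)

    allPairs-unique : Unique allPairs
    allPairs-unique = subst Unique (sym (allPairs≡cartesianProduct (allFin n) (allFin n)))
      (Unique.cartesianProduct⁺ (Unique.allFin⁺ n) (Unique.allFin⁺ n))

    ∈-allPairs : ∀ p → p ∈ allPairs
    ∈-allPairs (i , j) = subst ((i , j) ∈_) (sym (allPairs≡cartesianProduct (allFin n) (allFin n)))
      (∈-cartesianProduct⁺ (∈-allFin i) (∈-allFin j))

  edgeList-unique : ∀ (H : Graph n) → Unique (edgeList H)
  edgeList-unique H = Unique.filter⁺ _ (Unique.filter⁺ _ allPairs-unique)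

  ∈-edgeList⁻ : ∀ (H : Graph n) {p} → p ∈ edgeList H → Ordered p × IsEdge H p
  ∈-edgeList⁻ H p∈E with ∈-filter⁻ _ p∈E
  ... | p∈ordered , p∈H = proj₂ (∈-filter⁻ _ {xs = allPairs} p∈ordered) , p∈H

  ∈-edgeList⁺ : ∀ (H : Graph n) {p} → Ordered p → IsEdge H p → p ∈ edgeList H
  ∈-edgeList⁺ H {p} ordered p∈H = ∈-filter⁺ _ (∈-filter⁺ _ (∈-allPairs p) ordered) p∈H

  adj⇒≢ : ∀ (H : Graph n) {x y} → adj H x y ≡ true → x ≢ y
  adj⇒≢ H {x} xy∈H refl = contradiction (trans (sym (adj-irrefl H x)) xy∈H) λ ()

  sortPair-∈-edgeList : ∀ (H : Graph n) {x y} → adj H x y ≡ true → sortPair x y ∈ edgeList H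
  sortPair-∈-edgeList H {x} {y} xy∈H =
    ∈-edgeList⁺ H (sortPair-ordered {x} {y} (adj⇒≢ H xy∈H)) (isEdge (sortPair-cases x y))
    where
    isEdge : sortPair x y ≡ (x , y) ⊎ sortPair x y ≡ (y , x) → IsEdge H (sortPair x y)
    isEdge (inj₁ eq) = subst (IsEdge H) (sym eq) xy∈H
    isEdge (inj₂ eq) = subst (IsEdge H) (sym eq) (trans (adj-sym H y x) xy∈H)

  neighbours : Graph n → Fin n → List (Fin n)
  neighbours H x = filter (λ y → adj H x y Bool.≟ true) (allFin n)

  ∈-neighbours⁺ : ∀ (H : Graph n) {x y} → adj H x y ≡ true → y ∈ neighbours H x
  ∈-neighbours⁺ H {y = y} xy∈H = ∈-filter⁺ _ (∈-allFin y) xy∈H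

  neighbours-cong : ∀ (H H′ : Graph n) {x x′} → (∀ y → adj H x y ≡ adj H′ x′ y) →
                    neighbours H x ≡ neighbours H′ x′
  neighbours-cong H H′ same =
    filter-≐ _ _ ((λ {y} e → trans (sym (same y)) e) , (λ {y} e → trans (same y) e)) (allFin n)

  star : Graph n → Fin n → List Pair
  star H x = map (sortPair x) (neighbours H x)

  ∈-star⁺ : ∀ (H : Graph n) {x y} → adj H x y ≡ true → sortPair x y ∈ star H x
  ∈-star⁺ H {x} xy∈H = ∈-map⁺ (sortPair x) (∈-neighbours⁺ H xy∈H)

  ∈-star⁻ : ∀ (H : Graph n) {x p} → p ∈ star H x → ∃ λ y → adj H x y ≡ true × p ≡ sortPair x y
  ∈-star⁻ H {x} p∈star with ∈-map⁻ (sortPair x) p∈star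
  ... | y , y∈N , refl = y , proj₂ (∈-filter⁻ _ {xs = allFin n} y∈N) , refl

  star-unique : ∀ (H : Graph n) x → Unique (star H x)
  star-unique H x = Unique.map⁺ sortPair-injʳ (Unique.filter⁺ _ (Unique.allFin⁺ n))

  Avoids : Fin n → Pair → Set
  Avoids w (i , j) = i ≢ w × j ≢ w

  avoids? : ∀ w p → Dec (Avoids w p)
  avoids? w (i , j) = ¬? (i ≟ w) ×-dec ¬? (j ≟ w)

  ¬avoids-sortPair : ∀ w y → ¬ Avoids w (sortPair w y)
  ¬avoids-sortPair w y with sortPair w y | sortPair-cases w y
  ... | _ | inj₁ refl = λ avoids → proj₁ avoids refl
  ... | _ | inj₂ refl = λ avoids → proj₂ avoids refl

  edgesAvoiding : Graph n → Fin n → Fin n → List Pair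
  edgesAvoiding H u v = filter (λ p → avoids? u p ×-dec avoids? v p) (edgeList H)

  edgesAvoiding-comm : ∀ (H : Graph n) u v → edgesAvoiding H u v ≡ edgesAvoiding H v u
  edgesAvoiding-comm H u v = filter-≐ _ _ ((λ (p , q) → q , p) , (λ (p , q) → q , p)) (edgeList H)

  edgesAvoiding-↭ : ∀ (H H′ : Graph n) {u v} →
                    (∀ {x y} → x ≢ u → x ≢ v → y ≢ u → y ≢ v → adj H x y ≡ adj H′ x y) →
                    edgesAvoiding H u v ↭ edgesAvoiding H′ u v
  edgesAvoiding-↭ H H′ {u} {v} same = ∼bag⇒↭ (unique∧set⇒bag (unique H) (unique H′)
    (mk⇔ (transfer H H′ same) (transfer H′ H λ x≢u x≢v y≢u y≢v → sym (same x≢u x≢v y≢u y≢v))))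
    where
    unique : ∀ H → Unique (edgesAvoiding H u v)
    unique H = Unique.filter⁺ _ (edgeList-unique H)
    transfer : ∀ H H′ → (∀ {x y} → x ≢ u → x ≢ v → y ≢ u → y ≢ v → adj H x y ≡ adj H′ x y) →
               ∀ {p} → p ∈ edgesAvoiding H u v → p ∈ edgesAvoiding H′ u v
    transfer H H′ same {i , j} p∈A with ∈-filter⁻ _ {xs = edgeList H} p∈A
    ... | p∈E , avoids@((i≢u , j≢u) , (i≢v , j≢v)) with ∈-edgeList⁻ H p∈E
    ...   | ordered , ij∈H =
      ∈-filter⁺ _ (∈-edgeList⁺ H′ ordered (trans (sym (same i≢u i≢v j≢u j≢v)) ij∈H)) avoids

  ∈-star-incident : ∀ (H : Graph n) {w p} → p ∈ edgeList H → ¬ Avoids w p → p ∈ star H w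
  ∈-star-incident H {w} {i , j} p∈E ¬avoids with ∈-edgeList⁻ H p∈E | i ≟ w | j ≟ w
  ... | i<j , ij∈H | yes refl | _        = subst (_∈ star H i) (sortPair-< i<j) (∈-star⁺ H ij∈H)
  ... | i<j , ij∈H | no _     | yes refl =
    subst (_∈ star H j) (trans (sortPair-comm (λ eq → <⇒≢ i<j (sym eq))) (sortPair-< i<j))
          (∈-star⁺ H (trans (adj-sym H j i) ij∈H))
  ... | _          | no i≢w   | no j≢w   = contradiction (i≢w , j≢w) ¬avoids

  edgeList-↭ : ∀ (H : Graph n) {u v} → adj H u v ≡ false → u ≢ v →
               edgeList H ↭ edgesAvoiding H u v ++ (star H u ++ star H v)
  edgeList-↭ H {u} {v} uv∉H u≢v =
    ∼bag⇒↭ (unique∧set⇒bag (edgeList-unique H) unique (mk⇔ split merge))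
    where
    -- The stars of u and v are disjoint because uv is not an edge.
    stars-disjoint : Disjoint (star H u) (star H v)
    stars-disjoint (p∈Su , p∈Sv) with ∈-star⁻ H p∈Su | ∈-star⁻ H p∈Sv
    ... | y , _ , refl | y′ , vy′∈H , eq with sortPair-≡⁻ eq
    ...   | inj₁ (u≡v , _)    = u≢v u≡v
    ...   | inj₂ (refl , refl) = contradiction (trans (sym uv∉H) (trans (adj-sym H u v) vy′∈H)) λ ()
    avoiding-disjoint : Disjoint (edgesAvoiding H u v) (star H u ++ star H v)
    avoiding-disjoint (p∈A , p∈S)
      with proj₂ (∈-filter⁻ _ {xs = edgeList H} p∈A) | ∈-++⁻ (star H u) p∈S
    ... | avoids-u , _ | inj₁ p∈Su with ∈-star⁻ H p∈Su
    ...   | y , _ , refl = ¬avoids-sortPair u y avoids-u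
    avoiding-disjoint (p∈A , p∈S) | _ , avoids-v | inj₂ p∈Sv with ∈-star⁻ H p∈Sv
    ...   | y , _ , refl = ¬avoids-sortPair v y avoids-v
    unique : Unique (edgesAvoiding H u v ++ (star H u ++ star H v))
    unique = Unique.++⁺ (Unique.filter⁺ _ (edgeList-unique H))
                        (Unique.++⁺ (star-unique H u) (star-unique H v) stars-disjoint) avoiding-disjoint
    split : ∀ {p} → p ∈ edgeList H → p ∈ edgesAvoiding H u v ++ (star H u ++ star H v)
    split {p} p∈E with avoids? u p | avoids? v p
    ... | yes avoids-u | yes avoids-v = ∈-++⁺ˡ (∈-filter⁺ _ p∈E (avoids-u , avoids-v))
    ... | no ¬avoids-u | _            =
      ∈-++⁺ʳ (edgesAvoiding H u v) (∈-++⁺ˡ (∈-star-incident H p∈E ¬avoids-u))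
    ... | yes _        | no ¬avoids-v =
      ∈-++⁺ʳ (edgesAvoiding H u v) (∈-++⁺ʳ (star H u) (∈-star-incident H p∈E ¬avoids-v))
    ∈-star⇒∈-edgeList : ∀ {w p} → p ∈ star H w → p ∈ edgeList H
    ∈-star⇒∈-edgeList p∈S with ∈-star⁻ H p∈S
    ... | _ , wy∈H , refl = sortPair-∈-edgeList H wy∈H
    merge : ∀ {p} → p ∈ edgesAvoiding H u v ++ (star H u ++ star H v) → p ∈ edgeList H
    merge p∈ with ∈-++⁻ (edgesAvoiding H u v) p∈
    ... | inj₁ p∈A = proj₁ (∈-filter⁻ _ {xs = edgeList H} p∈A)
    ... | inj₂ p∈S with ∈-++⁻ (star H u) p∈S
    ...   | inj₁ p∈Su = ∈-star⇒∈-edgeList p∈Su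
    ...   | inj₂ p∈Sv = ∈-star⇒∈-edgeList p∈Sv

module Factorisation {n r k : ℕ} (F : Coloring (K k) r) where
  open import Data.Bool using (Bool; true; false; if_then_else_)
  import Data.Bool as Bool
  open import Data.Fin using (Fin)
  open import Data.List using (List; []; _∷_; _++_; length; allFin)
  open import Data.List.Properties using (map-cong)
  open import Data.List.Membership.Propositional using (find; lose)
  open import Data.List.Relation.Unary.All as All using (All; []; _∷_)
  open import Data.List.Relation.Unary.All.Properties using (All¬⇒¬Any)
  open import Data.List.Relation.Unary.AllPairs using (_∷_)
  open import Data.List.Relation.Unary.Any using (Any; any?)
  open import Data.List.Relation.Unary.Unique.Propositional using (Unique)
  open import Data.Maybe using (just; nothing)
  open import Data.Nat using (_*_)
  open import Data.Nat.ListAction using (sum)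
  open import Data.Product using (_,_; proj₁; proj₂)
  open import Data.Sum using (inj₁; inj₂)
  open import Data.Vec using (_∷_)
  open import Function.Bundles using (mk⇔)
  open import Relation.Nullary using (Dec; yes; no; does)
  open import Relation.Nullary.Decidable using (does-⇔)
  open import Relation.Binary.PropositionalEquality
    using (_≡_; _≢_; refl; sym; trans; cong; cong₂; subst; module ≡-Reasoning)

  open Copies {n} {r} {k} F
  open Edges n
  open Recolouring _≟ₚ_ r

  colourBy : Graph n → Colouring → ColourFn
  colourBy H σ x y = if adj H x y then just (σ (sortPair x y)) else nothing

  colourBy-≡ : ∀ (H H′ : Graph n) σ σ′ {x y x′ y′} → adj H x y ≡ adj H′ x′ y′ →
               σ (sortPair x y) ≡ σ′ (sortPair x′ y′) → colourBy H σ x y ≡ colourBy H′ σ′ x′ y′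
  colourBy-≡ H H′ σ σ′ same-adj same-colour =
    cong₂ (λ e c → if e then just c else nothing) same-adj same-colour

  free-colourBy-cong : ∀ A (H : Graph n) {σ τ} →
                       (∀ x y → A x y ≡ true → σ (sortPair x y) ≡ τ (sortPair x y)) →
                       free A (colourBy H σ) ≡ free A (colourBy H τ)
  free-colourBy-cong A H {σ} {τ} agree =
    free-cong {A} {colourBy H σ} {A} {colourBy H τ}
      (λ x y xy∈A → xy∈A , colourBy-≡ H H τ σ refl (sym (agree x y xy∈A)))
      (λ x y xy∈A → xy∈A , colourBy-≡ H H σ τ refl (agree x y xy∈A))

  free-colourBy-extensional : ∀ A (H : Graph n) → Extensional (λ σ → free A (colourBy H σ))
  free-colourBy-extensional A H {σ} {τ} σ≗τ =
    free-colourBy-cong A H {σ} {τ} (λ x y _ → σ≗τ (sortPair x y))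

  free-─-ignores : ∀ (H : Graph n) y z →
                   Ignores (sortPair y z) (λ σ → free (adj H ─ y) (colourBy H σ))
  free-─-ignores H y z σ a =
    free-colourBy-cong (adj H ─ y) H {σ [ sortPair y z ]≔ a} {σ} λ x x′ xx′∈H─y →
    let x≢y , x′≢y , _ = ─-true⁻ {adj H} xx′∈H─y in
    []≔-there σ {sortPair y z} {sortPair x x′} a (sortPair-avoids {y} {x} {x′} z x≢y x′≢y)

  free-─-cong : ∀ (H H′ : Graph n) w → (∀ {x y} → x ≢ w → y ≢ w → adj H x y ≡ adj H′ x y) → ∀ σ →
                free (adj H ─ w) (colourBy H σ) ≡ free (adj H′ ─ w) (colourBy H′ σ)
  free-─-cong H H′ w same σ =
    free-cong {adj H ─ w} {colourBy H σ} {adj H′ ─ w} {colourBy H′ σ}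
      (agree H H′ same) (agree H′ H λ x≢w y≢w → sym (same x≢w y≢w))
    where
    agree : ∀ H H′ → (∀ {x y} → x ≢ w → y ≢ w → adj H x y ≡ adj H′ x y) →
            Transports (λ x → x) (adj H ─ w) (colourBy H σ) (adj H′ ─ w) (colourBy H′ σ)
    agree H H′ same x y xy∈H─w =
      let x≢w , y≢w , xy∈H = ─-true⁻ {adj H} xy∈H─w in
      ─-true⁺ {adj H′} x≢w y≢w (trans (sym (same x≢w y≢w)) xy∈H) ,
      colourBy-≡ H′ H σ σ (sym (same x≢w y≢w)) refl

  restrict : List Pair → Colouring → ColourFn
  restrict ps σ x y =
    if does (any? (λ p → matches? p x y) ps) then just (σ (sortPair x y)) else nothing

  countVec-assoc : ∀ (Q : ColourFn → Bool) → (∀ {C C′} → (∀ x y → C x y ≡ C′ x y) → Q C ≡ Q C′) →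
    ∀ ps → Unique ps → All Ordered ps → ∀ ρ →
    countVec r (length ps) (λ c → Q (assoc ps c)) ≡
    recolourSum ps (λ σ → if Q (restrict ps σ) then 1 else 0) ρ
  countVec-assoc Q Q-cong []       _               _                   ρ = refl
  countVec-assoc Q Q-cong (p ∷ ps) (p∉ps ∷ unique) (p-ordered ∷ ordered) ρ =
    cong sum (map-cong entry (allFin r))
    where
    entry : ∀ a → countVec r (length ps) (λ c → Q (assoc (p ∷ ps) (a ∷ c))) ≡
                  recolourSum ps (λ σ → if Q (restrict (p ∷ ps) σ) then 1 else 0) (ρ [ p ]≔ a)
    entry a = begin
      countVec r (length ps) (λ c → Q (assoc (p ∷ ps) (a ∷ c)))
        ≡⟨ countVec-assoc Qₐ Qₐ-cong ps unique ordered (ρ [ p ]≔ a) ⟩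
      recolourSum ps (λ σ → if Qₐ (restrict ps σ) then 1 else 0) (ρ [ p ]≔ a)
        ≡⟨ recolourSum-fixed p a ps (All¬⇒¬Any p∉ps)
             (λ σ σp≡a → cong (λ b → if b then 1 else 0) (Q-cong (restrict-∷ σ σp≡a)))
             (ρ [ p ]≔ a) ([]≔-here ρ p a) ⟩
      recolourSum ps (λ σ → if Q (restrict (p ∷ ps) σ) then 1 else 0) (ρ [ p ]≔ a) ∎
      where
      open ≡-Reasoning
      Qₐ : ColourFn → Bool
      Qₐ C = Q (λ x y → if does (matches? p x y) then just a else C x y)
      Qₐ-cong : ∀ {C C′} → (∀ x y → C x y ≡ C′ x y) → Qₐ C ≡ Qₐ C′
      Qₐ-cong C≐C′ = Q-cong (λ x y → cong (if does (matches? p x y) then just a else_) (C≐C′ x y))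
      restrict-∷ : ∀ σ → σ p ≡ a → ∀ x y →
                   (if does (matches? p x y) then just a else restrict ps σ x y) ≡ restrict (p ∷ ps) σ x y
      restrict-∷ σ σp≡a x y = by-cases (matches? p x y)
        where
        by-cases : (p~xy? : Dec (Matches p x y)) →
          (if does p~xy? then just a else restrict ps σ x y) ≡
          (if does p~xy? Bool.∨ does (any? (λ q → matches? q x y) ps)
           then just (σ (sortPair x y)) else nothing)
        by-cases (yes p~xy) = cong just (sym (trans (cong σ (matches-sortPair p-ordered p~xy)) σp≡a))
        by-cases (no  _)    = refl

  private
    does-≟-true : ∀ b → does (b Bool.≟ true) ≡ b
    does-≟-true false = refl
    does-≟-true true  = refl

  any-matches-edgeList : ∀ (H : Graph n) x y →
                         does (any? (λ p → matches? p x y) (edgeList H)) ≡ adj H x y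
  any-matches-edgeList H x y =
    trans (does-⇔ (mk⇔ matched (λ xy∈H → lose (sortPair-∈-edgeList H xy∈H) (sortPair-matches x y)))
                  (any? (λ p → matches? p x y) (edgeList H)) (adj H x y Bool.≟ true))
          (does-≟-true (adj H x y))
    where
    edge-matched : ∀ {p} → IsEdge H p → Matches p x y → adj H x y ≡ true
    edge-matched ij∈H (inj₁ (refl , refl)) = ij∈H
    edge-matched ij∈H (inj₂ (refl , refl)) = trans (adj-sym H x y) ij∈H
    matched : Any (λ p → Matches p x y) (edgeList H) → adj H x y ≡ true
    matched m with find m
    ... | p , p∈E , p~xy = edge-matched {p} (proj₂ (∈-edgeList⁻ H p∈E)) p~xy

  cFree-recolourSum : ∀ (H : Graph n) ρ →
                      cFree r k F H ≡ recolourSum (edgeList H) (λ σ → free (adj H) (colourBy H σ)) ρ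
  cFree-recolourSum H ρ = trans
    (countVec-assoc (isFree (adj H))
       (λ {C} {C′} C≐C′ → isFree-cong {adj H} {C} {adj H} {C′}
                            (λ x y xy∈H → xy∈H , sym (C≐C′ x y)) (λ x y xy∈H → xy∈H , C≐C′ x y))
       (edgeList H) (edgeList-unique H) (All.tabulate (λ p∈E → proj₁ (∈-edgeList⁻ H p∈E))) ρ)
    (recolourSum-cong (λ σ → free-cong {adj H} {restrict (edgeList H) σ} {adj H} {colourBy H σ}
                               (λ x y xy∈H → xy∈H , sym (restrict-edgeList σ x y))
                               (λ x y xy∈H → xy∈H , restrict-edgeList σ x y))
                      (edgeList H) ρ)
    where
    restrict-edgeList : ∀ σ x y → restrict (edgeList H) σ x y ≡ colourBy H σ x y
    restrict-edgeList σ x y =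
      cong (λ b → if b then just (σ (sortPair x y)) else nothing) (any-matches-edgeList H x y)

  all-star : ∀ (H : Graph n) y {P : Pair → Set} → (∀ z → P (sortPair y z)) → All P (star H y)
  all-star H y {P} Pyz = All.tabulate λ p∈S →
    let z , _ , p≡yz = ∈-star⁻ H p∈S in subst P (sym p≡yz) (Pyz z)

  starCount : Graph n → Fin n → Fin n → Colouring → ℕ
  starCount H x y = recolourSum (star H x) (λ σ → free (adj H ─ y) (colourBy H σ))

  starCount-extensional : ∀ (H : Graph n) x y → Extensional (starCount H x y)
  starCount-extensional H x y =
    recolourSum-extensional (free-colourBy-extensional (adj H ─ y) H) (star H x)

  -- For a non-edge uv, a colouring of H is F-free iff H − v and H − u are, and the edges at u
  -- only matter to H − v while those at v only matter to H − u.
  cFree-factor : ∀ (H : Graph n) {u v} → adj H u v ≡ false → u ≢ v → ∀ ρ →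
    cFree r k F H ≡ recolourSum (edgesAvoiding H u v) (λ σ → starCount H u v σ * starCount H v u σ) ρ
  cFree-factor H {u} {v} uv∉H u≢v ρ = begin
    cFree r k F H
      ≡⟨ cFree-recolourSum H ρ ⟩
    recolourSum (edgeList H) free-H ρ
      ≡⟨ recolourSum-↭ {free-H} (ext (adj H)) (edgeList-↭ H uv∉H u≢v) ρ ⟩
    recolourSum (edgesAvoiding H u v ++ (star H u ++ star H v)) free-H ρ
      ≡⟨ recolourSum-++ free-H (edgesAvoiding H u v) _ ρ ⟩
    recolourSum (edgesAvoiding H u v) (recolourSum (star H u ++ star H v) free-H) ρ
      ≡⟨ recolourSum-cong stars (edgesAvoiding H u v) ρ ⟩
    recolourSum (edgesAvoiding H u v) (λ σ → starCount H u v σ * starCount H v u σ) ρ ∎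
    where
    open ≡-Reasoning
    free-H free-H─u free-H─v : Colouring → ℕ
    free-H   σ = free (adj H) (colourBy H σ)
    free-H─u σ = free (adj H ─ u) (colourBy H σ)
    free-H─v σ = free (adj H ─ v) (colourBy H σ)
    ext : ∀ A → Extensional (λ σ → free A (colourBy H σ))
    ext A = free-colourBy-extensional A H
    star-v : ∀ τ → recolourSum (star H v) free-H τ ≡ free-H─v τ * starCount H v u τ
    star-v τ = begin
      recolourSum (star H v) free-H τ
        ≡⟨ recolourSum-cong (λ τ′ → free-split H uv∉H u≢v (colourBy H τ′)) (star H v) τ ⟩
      recolourSum (star H v) (λ τ′ → free-H─v τ′ * free-H─u τ′) τ
        ≡⟨ recolourSum-*ˡ {free-H─v} {free-H─u} (ext (adj H ─ u)) (star H v)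
             (all-star H v {λ p → Ignores p free-H─v} (free-─-ignores H v)) τ ⟩
      free-H─v τ * starCount H v u τ ∎
    stars : ∀ σ → recolourSum (star H u ++ star H v) free-H σ ≡ starCount H u v σ * starCount H v u σ
    stars σ = begin
      recolourSum (star H u ++ star H v) free-H σ
        ≡⟨ recolourSum-++ free-H (star H u) (star H v) σ ⟩
      recolourSum (star H u) (recolourSum (star H v) free-H) σ
        ≡⟨ recolourSum-cong star-v (star H u) σ ⟩
      recolourSum (star H u) (λ τ → free-H─v τ * starCount H v u τ) σ
        ≡⟨ recolourSum-*ʳ {free-H─v} {starCount H v u} (ext (adj H ─ v)) (star H u)
             (all-star H u {λ p → Ignores p (starCount H v u)}
               (λ z → recolourSum-ignores {free-H─u} (ext (adj H ─ u)) (free-─-ignores H u z) (star H v))) σ ⟩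
      starCount H u v σ * starCount H v u σ ∎

module Cloning {n r k : ℕ} (F : Coloring (K k) r) where
  open import Data.Bool using (true; false; if_then_else_)
  open import Data.Fin using (Fin; _≟_)
  open import Data.Fin.Permutation.Components using (transpose; transpose-inverse)
  open import Data.List using (List; []; _∷_; map)
  open import Data.List.Membership.Propositional using (_∈_)
  open import Data.List.Relation.Unary.Any using (here; there)
  open import Data.Nat using (_*_)
  open import Data.Product using (_×_; _,_; proj₁; proj₂)
  open import Data.Sum using (_⊎_; inj₁; inj₂)
  open import Relation.Nullary using (Dec; yes; no; does)
  open import Relation.Nullary.Negation using (contradiction)
  open import Relation.Binary.PropositionalEquality
    using (_≡_; _≢_; _≗_; refl; sym; trans; cong; cong₂; module ≡-Reasoning)

  open Sums using (sq)
  open Copies {n} {r} {k} F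
  open Edges n
  open Recolouring _≟ₚ_ r
  open Factorisation {n} {r} {k} F

  -- cloneOver G a b has adjacency adj G (redirect a b x) (redirect a b y), definitionally.
  redirect : Fin n → Fin n → Fin n → Fin n
  redirect a b x = if does (x ≟ b) then a else x

  redirect-target : ∀ a b → redirect a b b ≡ a
  redirect-target a b with b ≟ b
  ... | yes _   = refl
  ... | no  b≢b = contradiction refl b≢b

  redirect-other : ∀ a {b x} → x ≢ b → redirect a b x ≡ x
  redirect-other a {b} {x} x≢b with x ≟ b
  ... | yes x≡b = contradiction x≡b x≢b
  ... | no  _   = refl

  transpose-first : ∀ (i j : Fin n) → transpose i j i ≡ j
  transpose-first i j with i ≟ i
  ... | yes _   = refl
  ... | no  i≢i = contradiction refl i≢i

  transpose-other : ∀ {i j x : Fin n} → x ≢ i → x ≢ j → transpose i j x ≡ x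
  transpose-other {i} {j} {x} x≢i x≢j with x ≟ i
  ... | yes x≡i = contradiction x≡i x≢i
  ... | no  _ with x ≟ j
  ...   | yes x≡j = contradiction x≡j x≢j
  ...   | no  _   = refl

  redirect-transpose : ∀ {a b x} → x ≢ b → redirect a b (transpose a b x) ≡ x
  redirect-transpose {a} {b} {x} x≢b = cases (x ≟ a)
    where
    cases : Dec (x ≡ a) → redirect a b (transpose a b x) ≡ x
    cases (yes refl) = trans (cong (redirect a b) (transpose-first a b)) (redirect-target a b)
    cases (no  x≢a)  = trans (cong (redirect a b) (transpose-other x≢a x≢b)) (redirect-other a x≢b)

  redirect≡transpose : ∀ {a b x} → x ≢ a → redirect a b x ≡ transpose b a x
  redirect≡transpose {a} {b} {x} x≢a = cases (x ≟ b)
    where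
    cases : Dec (x ≡ b) → redirect a b x ≡ transpose b a x
    cases (yes refl) = trans (redirect-target a b) (sym (transpose-first b a))
    cases (no  x≢b)  = trans (redirect-other a x≢b) (sym (transpose-other x≢b x≢a))

  transpose-≢ : ∀ {i j x : Fin n} → i ≢ j → x ≢ j → transpose i j x ≢ i
  transpose-≢ {i} {j} {x} i≢j x≢j = cases (x ≟ i)
    where
    cases : Dec (x ≡ i) → transpose i j x ≢ i
    cases (yes refl) eq = i≢j (trans (sym eq) (transpose-first i j))
    cases (no  x≢i)  eq = x≢i (trans (sym (transpose-other x≢i x≢j)) eq)

  module _ (G : Graph n) {a b : Fin n} (a≢b : a ≢ b) (ab∉G : adj G a b ≡ false) where

    cloneOver-off : ∀ {x y} → x ≢ b → y ≢ b → adj (cloneOver G a b) x y ≡ adj G x y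
    cloneOver-off x≢b y≢b = cong₂ (adj G) (redirect-other a x≢b) (redirect-other a y≢b)

    cloneOver-ab : adj (cloneOver G a b) a b ≡ false
    cloneOver-ab = trans (cong₂ (adj G) (redirect-other a a≢b) (redirect-target a b)) (adj-irrefl G a)

    private
      adj-a-redirect : ∀ y → adj G a (redirect a b y) ≡ adj G a y
      adj-a-redirect y with y ≟ b
      ... | yes refl = trans (adj-irrefl G a) (sym ab∉G)
      ... | no  _    = refl

    cloneOver-at-original : ∀ y → adj (cloneOver G a b) a y ≡ adj G a y
    cloneOver-at-original y =
      trans (cong (λ x → adj G x (redirect a b y)) (redirect-other a a≢b)) (adj-a-redirect y)

    cloneOver-at-clone : ∀ y → adj (cloneOver G a b) b y ≡ adj G a y
    cloneOver-at-clone y =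
      trans (cong (λ x → adj G x (redirect a b y)) (redirect-target a b)) (adj-a-redirect y)

    star-cloneOver-original : star (cloneOver G a b) a ≡ star G a
    star-cloneOver-original =
      cong (map (sortPair a)) (neighbours-cong (cloneOver G a b) G {a} {a} cloneOver-at-original)

    star-cloneOver-clone : star (cloneOver G a b) b ≡ map (sortPair b) (neighbours G a)
    star-cloneOver-clone =
      cong (map (sortPair b)) (neighbours-cong (cloneOver G a b) G {b} {a} cloneOver-at-clone)

    starCount-cloneOver-original : starCount (cloneOver G a b) a b ≗ starCount G a b
    starCount-cloneOver-original σ = begin
      starCount (cloneOver G a b) a b σ
        ≡⟨ cong (λ ps → recolourSum ps free-clone σ) star-cloneOver-original ⟩
      recolourSum (star G a) free-clone σ
        ≡⟨ recolourSum-cong (free-─-cong (cloneOver G a b) G b cloneOver-off) (star G a) σ ⟩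
      starCount G a b σ ∎
      where
      open ≡-Reasoning
      free-clone : Colouring → ℕ
      free-clone τ = free (adj (cloneOver G a b) ─ b) (colourBy (cloneOver G a b) τ)

    private
      G⁺ : Graph n
      G⁺ = cloneOver G a b

      π ψ : Fin n → Fin n
      π = transpose a b
      ψ = transpose b a

      π-injective : ∀ {x y} → π x ≡ π y → x ≡ y
      π-injective {x} {y} eq = trans (sym (transpose-inverse b a)) (trans (cong ψ eq) (transpose-inverse b a))

      ψ-injective : ∀ {x y} → ψ x ≡ ψ y → x ≡ y
      ψ-injective {x} {y} eq = trans (sym (transpose-inverse a b)) (trans (cong π eq) (transpose-inverse a b))

      -- σ₁ colours G and σ₂ the clone. While the neighbours ys of a remain to be recoloured,
      -- every edge a y of G with y ∉ ys already has the colour of the clone's edge b y.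
      Synced : List (Fin n) → Colouring → Colouring → Set
      Synced ys σ₁ σ₂ =
        (∀ {x y} → x ≢ a → x ≢ b → y ≢ a → y ≢ b → σ₁ (sortPair x y) ≡ σ₂ (sortPair x y)) ×
        (∀ {y} → adj G a y ≡ true → y ∈ ys ⊎ σ₁ (sortPair a y) ≡ σ₂ (sortPair b y))

      synced-step : ∀ {y ys σ₁ σ₂} c → Synced (y ∷ ys) σ₁ σ₂ →
                    Synced ys (σ₁ [ sortPair a y ]≔ c) (σ₂ [ sortPair b y ]≔ c)
      synced-step {y₀} {ys} {σ₁} {σ₂} c (off , at) = off′ , at′
        where
        off′ : ∀ {x y} → x ≢ a → x ≢ b → y ≢ a → y ≢ b →
               (σ₁ [ sortPair a y₀ ]≔ c) (sortPair x y) ≡ (σ₂ [ sortPair b y₀ ]≔ c) (sortPair x y)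
        off′ {x} {y} x≢a x≢b y≢a y≢b =
          trans ([]≔-there σ₁ {sortPair a y₀} {sortPair x y} c (sortPair-avoids {a} {x} {y} y₀ x≢a y≢a))
          (trans (off x≢a x≢b y≢a y≢b)
                 (sym ([]≔-there σ₂ {sortPair b y₀} {sortPair x y} c (sortPair-avoids {b} {x} {y} y₀ x≢b y≢b))))
        at′ : ∀ {y} → adj G a y ≡ true →
              y ∈ ys ⊎ (σ₁ [ sortPair a y₀ ]≔ c) (sortPair a y) ≡ (σ₂ [ sortPair b y₀ ]≔ c) (sortPair b y)
        at′ {y} ay∈G with y ≟ y₀
        ... | yes refl = inj₂ (trans ([]≔-here σ₁ (sortPair a y) c) (sym ([]≔-here σ₂ (sortPair b y) c)))
        ... | no y≢y₀ with at ay∈G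
        ...   | inj₁ (here y≡y₀)  = contradiction y≡y₀ y≢y₀
        ...   | inj₁ (there y∈ys) = inj₁ y∈ys
        ...   | inj₂ same =
          inj₂ (trans ([]≔-there σ₁ {sortPair a y₀} {sortPair a y} c (λ eq → y≢y₀ (sortPair-injʳ eq)))
               (trans same
                      (sym ([]≔-there σ₂ {sortPair b y₀} {sortPair b y} c (λ eq → y≢y₀ (sortPair-injʳ eq))))))

      synced-colours : ∀ {σ₁ σ₂} → Synced [] σ₁ σ₂ → ∀ {x y} → x ≢ b → y ≢ b → adj G x y ≡ true →
                       σ₂ (sortPair (π x) (π y)) ≡ σ₁ (sortPair x y)
      synced-colours {σ₁} {σ₂} (off , at) {x} {y} x≢b y≢b xy∈G = cases (x ≟ a) (y ≟ a)
        where
        colour-at : ∀ {z} → adj G a z ≡ true → σ₂ (sortPair b z) ≡ σ₁ (sortPair a z)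
        colour-at az∈G with at az∈G
        ... | inj₂ same = sym same
        cases : Dec (x ≡ a) → Dec (y ≡ a) → σ₂ (sortPair (π x) (π y)) ≡ σ₁ (sortPair x y)
        cases (yes refl) (yes refl) = contradiction (trans (sym (adj-irrefl G x)) xy∈G) λ ()
        cases (yes refl) (no y≢a)   =
          trans (cong₂ (λ p q → σ₂ (sortPair p q)) (transpose-first a b) (transpose-other y≢a y≢b))
                (colour-at xy∈G)
        cases (no x≢a)   (yes refl) =
          trans (cong₂ (λ p q → σ₂ (sortPair p q)) (transpose-other x≢a x≢b) (transpose-first a b))
          (trans (cong σ₂ (sortPair-comm {x} {b} x≢b))
          (trans (colour-at (trans (adj-sym G y x) xy∈G)) (cong σ₁ (sortPair-comm {y} {x} λ eq → x≢a (sym eq)))))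
        cases (no x≢a)   (no y≢a)   =
          trans (cong₂ (λ p q → σ₂ (sortPair p q)) (transpose-other x≢a x≢b) (transpose-other y≢a y≢b))
                (sym (off x≢a x≢b y≢a y≢b))

      synced-free : ∀ {σ₁ σ₂} → Synced [] σ₁ σ₂ →
                    free (adj G ─ b) (colourBy G σ₁) ≡ free (adj G⁺ ─ a) (colourBy G⁺ σ₂)
      synced-free {σ₁} {σ₂} synced =
        free-map π ψ π-injective ψ-injective
          {adj G ─ b} {colourBy G σ₁} {adj G⁺ ─ a} {colourBy G⁺ σ₂} forth back
        where
        forth : Transports π (adj G ─ b) (colourBy G σ₁) (adj G⁺ ─ a) (colourBy G⁺ σ₂)
        forth x y xy∈G─b =
          ─-true⁺ {adj G⁺} (transpose-≢ a≢b x≢b) (transpose-≢ a≢b y≢b) (trans adj-π xy∈G) ,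
          colourBy-≡ G⁺ G σ₂ σ₁ adj-π (synced-colours {σ₁} {σ₂} synced x≢b y≢b xy∈G)
          where
          x≢b : x ≢ b
          x≢b = proj₁ (─-true⁻ {adj G} {b} {x} {y} xy∈G─b)
          y≢b : y ≢ b
          y≢b = proj₁ (proj₂ (─-true⁻ {adj G} {b} {x} {y} xy∈G─b))
          xy∈G : adj G x y ≡ true
          xy∈G = proj₂ (proj₂ (─-true⁻ {adj G} {b} {x} {y} xy∈G─b))
          adj-π : adj G⁺ (π x) (π y) ≡ adj G x y
          adj-π = cong₂ (adj G) (redirect-transpose x≢b) (redirect-transpose y≢b)
        back : Transports ψ (adj G⁺ ─ a) (colourBy G⁺ σ₂) (adj G ─ b) (colourBy G σ₁)
        back x y xy∈G⁺─a =
          ─-true⁺ {adj G} ψx≢b ψy≢b (trans adj-ψ xy∈G⁺) ,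
          colourBy-≡ G G⁺ σ₁ σ₂ adj-ψ colour-ψ
          where
          x≢a : x ≢ a
          x≢a = proj₁ (─-true⁻ {adj G⁺} {a} {x} {y} xy∈G⁺─a)
          y≢a : y ≢ a
          y≢a = proj₁ (proj₂ (─-true⁻ {adj G⁺} {a} {x} {y} xy∈G⁺─a))
          xy∈G⁺ : adj G⁺ x y ≡ true
          xy∈G⁺ = proj₂ (proj₂ (─-true⁻ {adj G⁺} {a} {x} {y} xy∈G⁺─a))
          ψx≢b : ψ x ≢ b
          ψx≢b = transpose-≢ (λ eq → a≢b (sym eq)) x≢a
          ψy≢b : ψ y ≢ b
          ψy≢b = transpose-≢ (λ eq → a≢b (sym eq)) y≢a
          adj-ψ : adj G (ψ x) (ψ y) ≡ adj G⁺ x y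
          adj-ψ = sym (cong₂ (adj G) (redirect≡transpose x≢a) (redirect≡transpose y≢a))
          colour-ψ : σ₁ (sortPair (ψ x) (ψ y)) ≡ σ₂ (sortPair x y)
          colour-ψ = sym (trans (cong₂ (λ p q → σ₂ (sortPair p q)) (sym (transpose-inverse a b))
                                                                     (sym (transpose-inverse a b)))
                                (synced-colours {σ₁} {σ₂} synced ψx≢b ψy≢b (trans adj-ψ xy∈G⁺)))

      simulated : ∀ σ →
        recolourSum (map (sortPair a) (neighbours G a)) (λ τ → free (adj G ─ b) (colourBy G τ)) σ ≡
        recolourSum (map (sortPair b) (neighbours G a)) (λ τ → free (adj G⁺ ─ a) (colourBy G⁺ τ)) σ
      simulated σ = recolourSum-simulation (sortPair a) (sortPair b)
                  {λ τ → free (adj G ─ b) (colourBy G τ)}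
                  {λ τ → free (adj G⁺ ─ a) (colourBy G⁺ τ)}
                  Synced (λ {σ₁} {σ₂} → synced-free {σ₁} {σ₂})
                  (λ {y} {ys} {σ₁} {σ₂} → synced-step {y} {ys} {σ₁} {σ₂})
                  (neighbours G a) {σ} {σ}
                  ((λ _ _ _ _ → refl) , λ ay∈G → inj₁ (∈-neighbours⁺ G ay∈G))

    starCount-cloneOver-clone : starCount (cloneOver G a b) b a ≗ starCount G a b
    starCount-cloneOver-clone σ = begin
      starCount (cloneOver G a b) b a σ
        ≡⟨ cong (λ ps → recolourSum ps free-clone σ) star-cloneOver-clone ⟩
      recolourSum (map (sortPair b) (neighbours G a)) free-clone σ
        ≡⟨ sym (simulated σ) ⟩
      starCount G a b σ ∎
      where
      open ≡-Reasoning
      free-clone : Colouring → ℕ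
      free-clone τ = free (adj (cloneOver G a b) ─ a) (colourBy (cloneOver G a b) τ)

    cFree-cloneOver : ∀ ρ → cFree r k F (cloneOver G a b) ≡
                      recolourSum (edgesAvoiding G a b) (λ σ → sq (starCount G a b σ)) ρ
    cFree-cloneOver ρ = begin
      cFree r k F (cloneOver G a b)
        ≡⟨ cFree-factor (cloneOver G a b) cloneOver-ab a≢b ρ ⟩
      recolourSum (edgesAvoiding (cloneOver G a b) a b)
                  (λ σ → starCount (cloneOver G a b) a b σ * starCount (cloneOver G a b) b a σ) ρ
        ≡⟨ recolourSum-cong (λ σ → cong₂ _*_ (starCount-cloneOver-original σ) (starCount-cloneOver-clone σ))
                            (edgesAvoiding (cloneOver G a b) a b) ρ ⟩
      recolourSum (edgesAvoiding (cloneOver G a b) a b) (λ σ → sq (starCount G a b σ)) ρ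
        ≡⟨ recolourSum-↭ {λ σ → sq (starCount G a b σ)} (λ σ≗τ → cong₂ _*_ (ext σ≗τ) (ext σ≗τ))
             (edgesAvoiding-↭ (cloneOver G a b) G λ _ x≢b _ y≢b → cloneOver-off x≢b y≢b) ρ ⟩
      recolourSum (edgesAvoiding G a b) (λ σ → sq (starCount G a b σ)) ρ ∎
      where
      open ≡-Reasoning
      ext : Extensional (starCount G a b)
      ext = starCount-extensional G a b
open import Data.Fin using (fromℕ<)
open import Data.Nat using (_<_; _*_; z≤n; s≤s)
open import Data.Nat.Properties using (≤-trans; *-monoʳ-≤; module ≤-Reasoning)
open import Relation.Binary.PropositionalEquality using (sym; trans; cong; cong₂)

open Sums using (sq; m*m≤n*m⇒m≤n)
open Edges using (Pair; _≟ₚ_; edgesAvoiding; edgesAvoiding-comm)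
open Factorisation using (starCount; cFree-factor)
open Cloning using (cFree-cloneOver)

cFree-≤-cFree-cloneOver : ∀ {n r k} (F : Coloring (K k) r) (G : Graph n) → Extremal r k F G →
                          ∀ {u v} → u ≢ v → adj G u v ≡ false → (Pair n → Fin r) →
                          cFree r k F G ≤ cFree r k F (cloneOver G u v)
cFree-≤-cFree-cloneOver {n} {r} {k} F G extremal {u} {v} u≢v uv∉G ρ =
  m*m≤n*m⇒m≤n (cFree r k F G) (cFree r k F (cloneOver G u v)) (begin
    sq (cFree r k F G)
      ≡⟨ cong sq (cFree-factor {n} {r} {k} F G uv∉G u≢v ρ) ⟩
    sq (recolourSum (edgesAvoiding n G u v) (λ σ → a σ * b σ) ρ)
      ≤⟨ recolourSum-cauchySchwarz a b (edgesAvoiding n G u v) ρ ⟩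
    recolourSum (edgesAvoiding n G u v) (λ σ → sq (a σ)) ρ *
    recolourSum (edgesAvoiding n G u v) (λ σ → sq (b σ)) ρ
      ≡⟨ cong₂ _*_ (sym (cFree-cloneOver {n} {r} {k} F G u≢v uv∉G ρ))
                   (sym (trans (cFree-cloneOver {n} {r} {k} F G (λ eq → u≢v (sym eq)) vu∉G ρ)
                        (cong (λ ps → recolourSum ps (λ σ → sq (b σ)) ρ) (edgesAvoiding-comm n G v u)))) ⟩
    cFree r k F (cloneOver G u v) * cFree r k F (cloneOver G v u)
      ≤⟨ *-monoʳ-≤ (cFree r k F (cloneOver G u v)) (extremal (cloneOver G v u)) ⟩
    cFree r k F (cloneOver G u v) * cFree r k F G ∎)
  where
  open ≤-Reasoning
  open Recolouring (_≟ₚ_ n) r using (recolourSum; recolourSum-cauchySchwarz)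
  a b : (Pair n → Fin r) → ℕ
  a = starCount {n} {r} {k} F G u v
  b = starCount {n} {r} {k} F G v u
  vu∉G : adj G v u ≡ false
  vu∉G = trans (adj-sym G v u) uv∉G

corollary2p9 : (r k : ℕ) → 2 ≤ r → 3 ≤ k → (F : Coloring (K k) r) →
    (n : ℕ) (G : Graph n) → Extremal r k F G →
    (u v : Fin n) → u ≢ v → adj G u v ≡ false →
    Extremal r k F (cloneOver G u v)
corollary2p9 r k 2≤r _ F n G extremal u v u≢v uv∉G H =
  ≤-trans (extremal H) (cFree-≤-cFree-cloneOver {n} {r} {k} F G extremal u≢v uv∉G (λ _ → fromℕ< 0<r))
  where
  0<r : 0 < r
  0<r = ≤-trans (s≤s z≤n) 2≤r
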